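{- Let $B=(X,Y,E)$ be a bipartite chain graph with maximum degree $\Delta$, and let $t$ be the maximum size of a biclique in $B$. Then the number of edges of $B$ is $O(t\Delta)$, i.e. $|E|\le c\,t\Delta$ for an absolute constant $c$.
   Context: Two vertices $a,b$ are comparable if $N(a)\subseteq N(b)$ or $N(b)\subseteq N(a)$. A bipartite graph with bipartition $(X,Y)$ is a bipartite chain graph if any two vertices of $X$ are comparable and any two vertices of $Y$ are comparable. A biclique $K_{t,t}$ consists of $t$ vertices of $X$ and $t$ vertices of $Y$ that are pairwise adjacent across the sides; its size is $t$. -}

module Defs where

open import Data.Nat using (ℕ; zero; suc; _+_; _⊔_; _≤_)
open import Data.Fin using (Fin; zero; suc)
open import Data.Bool using (Bool; true; false)
open import Data.Product using (Σ; _×_; _,_)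
open import Data.Sum using (_⊎_)
open import Function.Definitions using (Injective)
open import Relation.Binary.PropositionalEquality using (_≡_)

-- A finite bipartite graph with sides X = Fin m, Y = Fin n,
-- given by its (decidable) adjacency relation.
BipGraph : ℕ → ℕ → Set
BipGraph m n = Fin m → Fin n → Bool

sumFin : ∀ {k} → (Fin k → ℕ) → ℕ
sumFin {zero}  f = 0
sumFin {suc k} f = f zero + sumFin (λ i → f (suc i))

-- maximum of a function over Fin k (0 for k = 0)
maxFin : ∀ {k} → (Fin k → ℕ) → ℕ
maxFin {zero}  f = 0
maxFin {suc k} f = f zero ⊔ maxFin (λ i → f (suc i))

b2n : Bool → ℕ
b2n true  = 1
b2n false = 0

module _ {m n : ℕ} (E : BipGraph m n) where

  degX : Fin m → ℕ
  degX x = sumFin (λ y → b2n (E x y))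

  degY : Fin n → ℕ
  degY y = sumFin (λ x → b2n (E x y))

  edges : ℕ
  edges = sumFin degX

  maxDegree : ℕ
  maxDegree = maxFin degX ⊔ maxFin degY

  NX⊆ : Fin m → Fin m → Set
  NX⊆ a b = ∀ y → E a y ≡ true → E b y ≡ true

  NY⊆ : Fin n → Fin n → Set
  NY⊆ a b = ∀ x → E x a ≡ true → E x b ≡ true

  IsChainGraph : Set
  IsChainGraph = (∀ a b → NX⊆ a b ⊎ NX⊆ b a) × (∀ a b → NY⊆ a b ⊎ NY⊆ b a)

  HasBiclique : ℕ → Set
  HasBiclique t = Σ (Fin t → Fin m) λ f → Σ (Fin t → Fin n) λ g →
    Injective _≡_ _≡_ f × Injective _≡_ _≡_ g × (∀ i j → E (f i) (g j) ≡ true)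

  IsMaxBicliqueSize : ℕ → Set
  IsMaxBicliqueSize t = HasBiclique t × (∀ s → HasBiclique s → s ≤ t)

-- Split X at degree t. A vertex of degree > t whose neighbourhood is smallest among such
-- vertices has its > t neighbours adjacent to every vertex of degree > t, so there are at
-- most t of those (else K_{t+1,t+1}), contributing at most tΔ edges. The neighbourhood of a
-- vertex of degree ≤ t that is largest among such vertices has at most t elements and
-- contains every edge leaving a low-degree vertex; each of its elements has degree ≤ Δ,
-- so these edges number at most tΔ as well. Hence |E| ≤ 2tΔ.
module Submission where

open import Defs
open import Data.Nat using (ℕ; zero; suc; _+_; _*_; _≤_; _<_; _⊔_; z≤n; s≤s; _<?_)
open import Data.Nat.Properties
open import Data.Fin using (Fin; zero; suc)
import Data.Fin.Properties as Fin
open import Data.Bool using (Bool; true; false; not; _∧_)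
open import Data.Bool.Properties using (not-injective)
open import Data.Product using (Σ; _×_; _,_)
open import Data.Sum using (_⊎_; inj₁; inj₂)
open import Data.Empty using (⊥-elim)
open import Function using (_∘_; flip)
open import Function.Definitions using (Injective)
open import Relation.Nullary using (¬_; yes; no; contradiction)
open import Relation.Nullary.Decidable using (⌊_⌋)
open import Relation.Binary.Core using (Rel)
open import Relation.Binary.Definitions using (Total; Transitive)
open import Relation.Binary.Consequences using (total⇒refl)
open import Relation.Binary.PropositionalEquality
open import Algebra.Properties.Semiring.Sum +-*-semiring
  using (sum; sum-cong-≗; ∑-distrib-+; ∑-comm; *-distribʳ-sum)

true≢false : true ≢ false
true≢false ()

sumFin≡sum : ∀ {k} (f : Fin k → ℕ) → sumFin f ≡ sum f
sumFin≡sum {zero}  f = refl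
sumFin≡sum {suc k} f = cong (f zero +_) (sumFin≡sum (f ∘ suc))

sumFin-mono : ∀ {k} {f g : Fin k → ℕ} → (∀ i → f i ≤ g i) → sumFin f ≤ sumFin g
sumFin-mono {zero}  f≤g = z≤n
sumFin-mono {suc k} f≤g = +-mono-≤ (f≤g zero) (sumFin-mono (f≤g ∘ suc))

sumFin-zero : ∀ {k} {f : Fin k → ℕ} → (∀ i → f i ≡ 0) → sumFin f ≡ 0
sumFin-zero {zero}  f≡0 = refl
sumFin-zero {suc k} f≡0 rewrite f≡0 zero = sumFin-zero (f≡0 ∘ suc)

sumFin-distrib-+ : ∀ {k} (f g : Fin k → ℕ) →
  sumFin (λ i → f i + g i) ≡ sumFin f + sumFin g
sumFin-distrib-+ f g = begin
  sumFin (λ i → f i + g i) ≡⟨ sumFin≡sum (λ i → f i + g i) ⟩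
  sum (λ i → f i + g i)    ≡⟨ ∑-distrib-+ f g ⟩
  sum f + sum g            ≡⟨ cong₂ _+_ (sumFin≡sum f) (sumFin≡sum g) ⟨
  sumFin f + sumFin g      ∎
  where open ≡-Reasoning

sumFin-distribʳ-* : ∀ {k} (f : Fin k → ℕ) c → sumFin (λ i → f i * c) ≡ sumFin f * c
sumFin-distribʳ-* f c = begin
  sumFin (λ i → f i * c) ≡⟨ sumFin≡sum (λ i → f i * c) ⟩
  sum (λ i → f i * c)    ≡⟨ *-distribʳ-sum c f ⟨
  sum f * c              ≡⟨ cong (_* c) (sumFin≡sum f) ⟨
  sumFin f * c           ∎
  where open ≡-Reasoning

sumFin-comm : ∀ {k l} (h : Fin k → Fin l → ℕ) →
  sumFin (λ x → sumFin (h x)) ≡ sumFin (λ y → sumFin (λ x → h x y))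
sumFin-comm h = begin
  sumFin (λ x → sumFin (h x))          ≡⟨ sumFin≡sum (λ x → sumFin (h x)) ⟩
  sum (λ x → sumFin (h x))             ≡⟨ sum-cong-≗ (sumFin≡sum ∘ h) ⟩
  sum (λ x → sum (h x))                ≡⟨ ∑-comm h ⟩
  sum (λ y → sum (λ x → h x y))        ≡⟨ sum-cong-≗ (λ y → sumFin≡sum (λ x → h x y)) ⟨
  sum (λ y → sumFin (λ x → h x y))     ≡⟨ sumFin≡sum (λ y → sumFin (λ x → h x y)) ⟨
  sumFin (λ y → sumFin (λ x → h x y))  ∎
  where open ≡-Reasoning

≤maxFin : ∀ {k} (f : Fin k → ℕ) i → f i ≤ maxFin f
≤maxFin f zero    = m≤m⊔n _ _
≤maxFin f (suc i) = ≤-trans (≤maxFin (f ∘ suc) i) (m≤n⊔m (f zero) _)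

count : ∀ {m} → (Fin m → Bool) → ℕ
count P = sumFin (b2n ∘ P)

select : ∀ {m} (P : Fin m → Bool) {k} → k ≤ count P →
  Σ (Fin k → Fin m) λ f → Injective _≡_ _≡_ f × (∀ i → P (f i) ≡ true)
select P {zero} _ = (λ ()) , (λ { {()} }) , (λ ())
select {zero} P {suc k} ()
select {suc m} P {suc k} k<count with P zero in P₀ | k<count
... | false | k<count′ with select (P ∘ suc) k<count′
...   | f , f-inj , Pf = suc ∘ f , f-inj ∘ Fin.suc-injective , Pf
select {suc m} P {suc k} _ | true | s≤s k≤count with select (P ∘ suc) k≤count
...   | f , f-inj , Pf = g , g-inj , Pg
  where
  g : Fin (suc k) → Fin (suc m)
  g zero    = zero
  g (suc i) = suc (f i)
  g-inj : Injective _≡_ _≡_ g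
  g-inj {zero}  {zero}  _  = refl
  g-inj {suc i} {suc j} eq = cong suc (f-inj (Fin.suc-injective eq))
  Pg : ∀ i → P (g i) ≡ true
  Pg zero    = P₀
  Pg (suc i) = Pf i

greatest : ∀ {m ℓ} {R : Rel (Fin m) ℓ} → Total R → Transitive R → (P : Fin m → Bool) →
  (∀ j → P j ≡ false) ⊎ Σ (Fin m) λ i → P i ≡ true × (∀ j → P j ≡ true → R j i)
greatest {zero} R-total R-trans P = inj₁ λ ()
greatest {suc m} {R = R} R-total R-trans P
  with P zero in P₀ | greatest (λ a b → R-total (suc a) (suc b)) R-trans (P ∘ suc)
... | false | inj₁ none = inj₁ λ { zero → P₀ ; (suc j) → none j }
... | false | inj₂ (i , Pi , max) =
  inj₂ (suc i , Pi , λ { zero P₀′ → ⊥-elim (true≢false (trans (sym P₀′) P₀)) ; (suc j) → max j })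
... | true | inj₁ none =
  inj₂ (zero , P₀ , λ { zero _ → R-refl ; (suc j) Pj → ⊥-elim (true≢false (trans (sym Pj) (none j))) })
  where
  R-refl : R zero zero
  R-refl = total⇒refl (resp₂ R) sym R-total refl
... | true | inj₂ (i , Pi , max) with R-total zero (suc i)
...   | inj₁ 0≤i = inj₂ (suc i , Pi , λ { zero _ → 0≤i ; (suc j) → max j })
...   | inj₂ i≤0 = inj₂ (zero , P₀ , λ { zero _ → R-refl ; (suc j) Pj → R-trans (max j Pj) i≤0 })
  where
  R-refl : R zero zero
  R-refl = total⇒refl (resp₂ R) sym R-total refl

m*n+m*o≤2*m*[n⊔o] : ∀ m n o → m * n + m * o ≤ 2 * m * (n ⊔ o)
m*n+m*o≤2*m*[n⊔o] m n o = begin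
  m * n + m * o               ≤⟨ +-mono-≤ (*-monoʳ-≤ m (m≤m⊔n n o)) (*-monoʳ-≤ m (m≤n⊔m n o)) ⟩
  m * (n ⊔ o) + m * (n ⊔ o)   ≡⟨ cong (m * (n ⊔ o) +_) (+-identityʳ _) ⟨
  2 * (m * (n ⊔ o))           ≡⟨ *-assoc 2 m (n ⊔ o) ⟨
  2 * m * (n ⊔ o)             ∎
  where open ≤-Reasoning

b2n-∧-≤ʳ : ∀ a b → b2n (a ∧ b) ≤ b2n b
b2n-∧-≤ʳ true  b = ≤-refl
b2n-∧-≤ʳ false b = z≤n

module _ {m n} (E : BipGraph m n) where

  ΔX ΔY : ℕ
  ΔX = maxFin (degX E)
  ΔY = maxFin (degY E)

  NX⊆-trans : Transitive (NX⊆ E)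
  NX⊆-trans a⊆b b⊆c y = b⊆c y ∘ a⊆b y

  module _ (comparable : Total (NX⊆ E)) (s : ℕ) where

    high : Fin m → Bool
    high x = ⌊ s <? degX E x ⌋

    high⇒< : ∀ {x} → high x ≡ true → s < degX E x
    high⇒< {x} _ with s <? degX E x
    ... | yes s<d = s<d

    ¬high⇒≤ : ∀ {x} → high x ≡ false → degX E x ≤ s
    ¬high⇒≤ {x} _ with s <? degX E x
    ... | no s≮d = ≮⇒≥ s≮d

    lowEdge : Fin m → Fin n → ℕ
    lowEdge x y = b2n (not (high x) ∧ E x y)

    degX-split : ∀ x → degX E x ≤ b2n (high x) * ΔX + sumFin (lowEdge x)
    degX-split x with s <? degX E x
    ... | yes _ = begin
      degX E x    ≤⟨ ≤maxFin (degX E) x ⟩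
      ΔX          ≡⟨ *-identityˡ ΔX ⟨
      1 * ΔX      ≤⟨ m≤m+n _ _ ⟩
      1 * ΔX + _  ∎
      where open ≤-Reasoning
    ... | no _ = ≤-refl

    high-biclique : s < count high → HasBiclique E (suc s)
    high-biclique s<count with greatest (flip comparable) (flip NX⊆-trans) high
    ... | inj₁ none = contradiction (subst (s <_) (sumFin-zero (cong b2n ∘ none)) s<count) n≮0
    ... | inj₂ (x₀ , high-x₀ , x₀-minimal)
      with select high s<count | select (E x₀) (high⇒< high-x₀)
    ... | f , f-inj , high-f | g , g-inj , E-x₀-g =
      f , g , f-inj , g-inj , λ i j → x₀-minimal (f i) (high-f i) (g j) (E-x₀-g j)

    low-column : ∀ x₁ → (∀ x → not (high x) ≡ true → NX⊆ E x x₁) →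
      ∀ y → sumFin (λ x → lowEdge x y) ≤ b2n (E x₁ y) * ΔY
    low-column x₁ x₁-maximal y with E x₁ y in E-x₁-y
    ... | true = begin
      sumFin (λ x → lowEdge x y)  ≤⟨ sumFin-mono (λ x → b2n-∧-≤ʳ (not (high x)) (E x y)) ⟩
      degY E y                    ≤⟨ ≤maxFin (degY E) y ⟩
      ΔY                          ≡⟨ *-identityˡ ΔY ⟨
      1 * ΔY                      ∎
      where open ≤-Reasoning
    ... | false = ≤-reflexive (sumFin-zero outside)
      where
      outside : ∀ x → lowEdge x y ≡ 0
      outside x with not (high x) in low-x | E x y in E-x-y
      ... | false | _     = refl
      ... | true  | false = refl
      ... | true  | true  = ⊥-elim (true≢false (trans (sym (x₁-maximal x low-x y E-x-y)) E-x₁-y))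

    low-edges : sumFin (sumFin ∘ lowEdge) ≤ s * ΔY
    low-edges with greatest comparable NX⊆-trans (not ∘ high)
    ... | inj₁ none = ≤-trans (≤-reflexive (sumFin-zero λ x → sumFin-zero λ y →
                        cong (λ b → b2n (b ∧ E x y)) (none x))) z≤n
    ... | inj₂ (x₁ , low-x₁ , x₁-maximal) = begin
      sumFin (sumFin ∘ lowEdge)                  ≡⟨ sumFin-comm lowEdge ⟩
      sumFin (λ y → sumFin (λ x → lowEdge x y))  ≤⟨ sumFin-mono (low-column x₁ x₁-maximal) ⟩
      sumFin (λ y → b2n (E x₁ y) * ΔY)           ≡⟨ sumFin-distribʳ-* (b2n ∘ E x₁) ΔY ⟩
      degX E x₁ * ΔY                             ≤⟨ *-monoˡ-≤ ΔY (¬high⇒≤ (not-injective low-x₁)) ⟩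
      s * ΔY                                     ∎
      where open ≤-Reasoning

    edges-bound : ¬ HasBiclique E (suc s) → edges E ≤ s * ΔX + s * ΔY
    edges-bound no-biclique = begin
      sumFin (degX E)                                   ≤⟨ sumFin-mono degX-split ⟩
      sumFin (λ x → b2n (high x) * ΔX + sumFin (lowEdge x))
        ≡⟨ sumFin-distrib-+ (λ x → b2n (high x) * ΔX) (sumFin ∘ lowEdge) ⟩
      sumFin (λ x → b2n (high x) * ΔX) + sumFin (sumFin ∘ lowEdge)
        ≡⟨ cong (_+ sumFin (sumFin ∘ lowEdge)) (sumFin-distribʳ-* (b2n ∘ high) ΔX) ⟩
      count high * ΔX + sumFin (sumFin ∘ lowEdge)       ≤⟨ +-mono-≤ (*-monoˡ-≤ ΔX few-high) low-edges ⟩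
      s * ΔX + s * ΔY                                   ∎
      where
      open ≤-Reasoning
      few-high : count high ≤ s
      few-high = ≮⇒≥ (no-biclique ∘ high-biclique)

lemma14 : Σ ℕ λ c → ∀ (m n : ℕ) (E : BipGraph m n) → IsChainGraph E →
    ∀ (t : ℕ) → IsMaxBicliqueSize E t →
    edges E ≤ c * t * maxDegree E
lemma14 = 2 , λ m n E (comparable , _) t (_ , maximal) → ≤-trans
  (edges-bound E comparable t (λ K → 1+n≰n (maximal _ K)))
  (m*n+m*o≤2*m*[n⊔o] t (ΔX E) (ΔY E))
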